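{- Let $G$ be a graph, $u\in V(G)$ and $i\geq 1$ an integer. Let $x,y,z$ be three distinct vertices in $N_i(u)$. Then there exists a set $S\subseteq \{u\}\cup N_1(u)\cup\cdots\cup N_{i-1}(u)$ such that the induced subgraph $G|(S\cup\{x,y,z\})$ is a confluence of $\{x,y,z\}$.
   Context: For $u\in V(G)$ and $i\geq 0$, $N_i(u)$ is the set of vertices at distance exactly $i$ from $u$; $G|X$ is the subgraph induced by $X$. A path $x_1\ldots x_n$ is an induced path ($x_jx_k$ is an edge iff $|j-k|=1$); its ends are $x_1,x_n$, and it may have length $0$. For three distinct vertices $x,y,z$, a graph $H$ is a confluence of $\{x,y,z\}$ if it is of one of two types. Type 1: $V(H)=V(P_x)\cup V(P_y)\cup V(P_z)$ where $P_x,P_y,P_z$ are paths with a common end $u'$, with other ends $x,y,z$ respectively, $P_x\setminus u'$, $P_y\setminus u'$, $P_z\setminus u'$ pairwise disjoint, and the edges of $H$ are exactly the edges of these paths. Type 2: $V(H)=V(P_x)\cup V(P_y)\cup V(P_z)$ where $P_x,P_y,P_z$ are pairwise disjoint paths with ends $x,x'$; $y,y'$; $z,z'$ respectively, $x'y'z'$ is a triangle, and the edges of $H$ are exactly the edges of the three paths together with the three edges of the triangle $x'y'z'$. -}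

module Defs where

open import Data.Nat using (ℕ; zero; suc; _<_)
open import Data.Fin using (Fin; zero; suc; toℕ; fromℕ; inject₁)
open import Data.Product using (Σ; ∃; _×_; _,_)
open import Data.Sum using (_⊎_)
open import Relation.Nullary using (¬_; Dec)
open import Relation.Binary.PropositionalEquality using (_≡_; _≢_)
open import Function.Bundles using (_⇔_)

record Graph (n : ℕ) : Set₁ where
  field
    E     : Fin n → Fin n → Set
    E-dec : ∀ a b → Dec (E a b)
    E-sym : ∀ {a b} → E a b → E b a
    E-irr : ∀ a → ¬ E a a
open Graph public

data Walk {n : ℕ} (G : Graph n) : Fin n → Fin n → ℕ → Set where
  here : ∀ {a} → Walk G a a zero
  step : ∀ {a b c k} → E G a b → Walk G b c k → Walk G a c (suc k)

Dist : ∀ {n} → Graph n → Fin n → Fin n → ℕ → Set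
Dist G u v i = Walk G u v i × (∀ j → j < i → ¬ Walk G u v j)

N : ∀ {n} → Graph n → ℕ → Fin n → Fin n → Set
N G i u v = Dist G u v i

record InducedPath {n : ℕ} (G : Graph n) (a b : Fin n) : Set where
  field
    len   : ℕ
    vtx   : Fin (suc len) → Fin n
    inj   : ∀ j l → vtx j ≡ vtx l → j ≡ l
    start : vtx zero ≡ a
    end   : vtx (fromℕ len) ≡ b
    edges : ∀ j l → E G (vtx j) (vtx l) ⇔ (toℕ l ≡ suc (toℕ j) ⊎ toℕ j ≡ suc (toℕ l))
open InducedPath public

OnPath : ∀ {n} {G : Graph n} {a b : Fin n} → InducedPath G a b → Fin n → Set
OnPath P v = ∃ λ j → vtx P j ≡ v

SamePair : ∀ {n} → Fin n → Fin n → Fin n → Fin n → Set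
SamePair c d a b = (c ≡ a × d ≡ b) ⊎ (c ≡ b × d ≡ a)

PathEdge : ∀ {n} {G : Graph n} {a b : Fin n} → InducedPath G a b → Fin n → Fin n → Set
PathEdge P c d = ∃ λ j → SamePair c d (vtx P (inject₁ j)) (vtx P (suc j))

-- X : vertex set of the induced subgraph G|X (given as a predicate).
-- Type 1 confluence of {x,y,z}.
ConfluenceType1 : ∀ {n} → (G : Graph n) → (Fin n → Set) → Fin n → Fin n → Fin n → Set
ConfluenceType1 G X x y z =
  Σ _ λ u' → Σ (InducedPath G u' x) λ Px → Σ (InducedPath G u' y) λ Py → Σ (InducedPath G u' z) λ Pz →
    (∀ v → OnPath Px v → OnPath Py v → v ≡ u') ×
    (∀ v → OnPath Px v → OnPath Pz v → v ≡ u') ×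
    (∀ v → OnPath Py v → OnPath Pz v → v ≡ u') ×
    (∀ v → X v ⇔ (OnPath Px v ⊎ OnPath Py v ⊎ OnPath Pz v)) ×
    (∀ c d → X c → X d → E G c d ⇔ (PathEdge Px c d ⊎ PathEdge Py c d ⊎ PathEdge Pz c d))

ConfluenceType2 : ∀ {n} → (G : Graph n) → (Fin n → Set) → Fin n → Fin n → Fin n → Set
ConfluenceType2 G X x y z =
  Σ _ λ x' → Σ _ λ y' → Σ _ λ z' →
  Σ (InducedPath G x x') λ Px → Σ (InducedPath G y y') λ Py → Σ (InducedPath G z z') λ Pz →
    (∀ v → OnPath Px v → ¬ OnPath Py v) ×
    (∀ v → OnPath Px v → ¬ OnPath Pz v) ×
    (∀ v → OnPath Py v → ¬ OnPath Pz v) ×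
    E G x' y' × E G y' z' × E G x' z' ×
    (∀ v → X v ⇔ (OnPath Px v ⊎ OnPath Py v ⊎ OnPath Pz v)) ×
    (∀ c d → X c → X d → E G c d ⇔
        (PathEdge Px c d ⊎ PathEdge Py c d ⊎ PathEdge Pz c d ⊎
         SamePair c d x' y' ⊎ SamePair c d y' z' ⊎ SamePair c d x' z'))

Confluence : ∀ {n} → (G : Graph n) → (Fin n → Set) → Fin n → Fin n → Fin n → Set
Confluence G X x y z = ConfluenceType1 G X x y z ⊎ ConfluenceType2 G X x y z

module Submission where

-- Join the shortest walks from u to x and to y at u and shortcut the result to an induced path P
-- from x to y; all its vertices except x and y are at distance less than i from u, so z is not on P.
-- Follow the shortest walk from z through u to x up to the first vertex q having a neighbour on P
-- and shortcut this part to an induced path Q from q to z, so that q is the only vertex of Q that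
-- sees P. Let p and r be the first and the last neighbour of q on P. If p = r, then P ∪ Q is a
-- confluence of type 1 centred at p; if pr is an edge of P, then the triangle pqr makes P ∪ Q a
-- confluence of type 2; otherwise the paths q p … x, q r … y and Q form one of type 1 centred at q.

open import Defs
open import Data.Nat using (ℕ; _≤_; _<_)
open import Data.Fin using (Fin)
open import Data.Fin.Subset using (Subset; _∈_)
open import Data.Product using (Σ; ∃; _×_)
open import Data.Sum using (_⊎_)
open import Relation.Binary.PropositionalEquality using (_≡_; _≢_)

open import Data.Empty using (⊥-elim)
open import Data.Fin using (zero; suc; toℕ; fromℕ; inject₁; _≟_)
open import Data.Fin.Properties using (toℕ-inject₁; any?)
open import Data.Fin.Subset using (⁅_⁆; _∪_) renaming (⊥ to ∅)
open import Data.Fin.Subset.Properties using (x∈p∪q⁺; x∈p∪q⁻; x∈⁅x⁆; x∈⁅y⁆⇒x≡y; ∉⊥)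
open import Data.List using (List; []; _∷_; _++_; reverse; [_]; length; lookup; foldr; filter)
open import Data.List.Properties using (++-assoc; unfold-reverse; reverse-++)
open import Data.List.Membership.Propositional using (lose) renaming (_∈_ to _∈ₗ_; _∉_ to _∉ₗ_)
open import Data.List.Membership.Propositional.Properties
  using (∈-++⁺ʳ; ∈-++⁻; ∈-lookup; ∈-filter⁺; ∈-filter⁻)
open import Data.List.Relation.Binary.Subset.Propositional using (_⊆_)
open import Data.List.Relation.Binary.Subset.Propositional.Properties
  using (∷⁺ʳ; ∈-∷⁺ʳ; xs⊆xs++ys; xs⊆ys++xs)
open import Data.List.Relation.Unary.All as All using (All; []; _∷_)
open import Data.List.Relation.Unary.All.Properties using (¬Any⇒All¬; anti-mono; ∷ʳ⁺)
open import Data.List.Relation.Unary.Any as Any using (Any; here; there)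
open import Data.List.Relation.Unary.Any.Properties using (reverse⁺; reverse⁻; lookup-index; ++↔)
open import Data.List.Relation.Unary.First using (FirstView) renaming (_++_∷_ to firstAt)
open import Data.Nat using (zero; suc; z≤n; s≤s; _+_)
open import Data.Nat.Properties
  using (suc-injective; m<n⇒m<1+n; n<1+n; m<1+n⇒m<n∨m≡n; ≤-pred; ≤-<-trans)
open import Data.Product using (_,_; proj₁; proj₂; ∃₂)
open import Data.Sum using (inj₁; inj₂)
import Data.Sum as Sum
open import Data.Sum.Function.Propositional using (_⊎-⇔_)
open import Function using (_∘_; id)
open import Function.Bundles using (_⇔_; mk⇔; Equivalence)
import Function.Properties.Equivalence as ⇔
open import Function.Properties.Inverse using (↔⇒⇔)
open import Relation.Binary.PropositionalEquality using (refl; sym; cong; subst; module ≡-Reasoning)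
open import Relation.Nullary using (¬_; Dec; yes; no)
open import Relation.Nullary.Decidable using (_⊎-dec_; _×-dec_; ¬?)
open import Relation.Unary using (Decidable; ∁)

Adjacent : ∀ {m} → Fin m → Fin m → Set
Adjacent j k = toℕ k ≡ suc (toℕ j) ⊎ toℕ j ≡ suc (toℕ k)

Adjacent-suc : ∀ {m} (j k : Fin m) → Adjacent (suc j) (suc k) ⇔ Adjacent j k
Adjacent-suc j k = suc≡suc⇔ ⊎-⇔ suc≡suc⇔
  where
  suc≡suc⇔ : ∀ {a b} → suc a ≡ suc b ⇔ a ≡ b
  suc≡suc⇔ = mk⇔ suc-injective (cong suc)

least-or-none : ∀ {P : ℕ → Set} → Decidable P → ∀ k →
  (∃ λ j → j < k × P j × (∀ m → m < j → ¬ P m)) ⊎ (∀ m → m < k → ¬ P m)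
least-or-none P? zero = inj₂ λ _ ()
least-or-none P? (suc k) with least-or-none P? k
... | inj₁ (j , j<k , pj , below) = inj₁ (j , m<n⇒m<1+n j<k , pj , below)
... | inj₂ none with P? k
...   | yes pk = inj₁ (k , n<1+n k , pk , none)
...   | no ¬pk = inj₂ λ m m<1+k → Sum.[ none m , (λ { refl → ¬pk }) ]′ (m<1+n⇒m<n∨m≡n m<1+k)

least : ∀ {P : ℕ → Set} → Decidable P → ∀ {k} → P k → ∃ λ j → j ≤ k × P j × (∀ m → m < j → ¬ P m)
least P? {k} pk with least-or-none P? (suc k)
... | inj₁ (j , j<1+k , pj , below) = j , ≤-pred j<1+k , pj , below
... | inj₂ none                     = ⊥-elim (none k (n<1+n k) pk)

module _ {A : Set} where

  data Ends : A → A → List A → Set where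
    [-] : ∀ {a} → Ends a a [ a ]
    _∷_ : ∀ a {b c l} → Ends b c l → Ends a c (a ∷ l)

  Ends-head : ∀ {a b c l} → Ends a b (c ∷ l) → c ≡ a
  Ends-head [-]     = refl
  Ends-head (_ ∷ _) = refl

  Ends-first∈ : ∀ {a b l} → Ends a b l → a ∈ₗ l
  Ends-first∈ [-]     = here refl
  Ends-first∈ (_ ∷ _) = here refl

  Ends-restart : ∀ {a b c l} → Ends a b (c ∷ l) → Ends c b (c ∷ l)
  Ends-restart [-]     = [-]
  Ends-restart (c ∷ e) = c ∷ e

  Ends-∷ʳ : ∀ {a b l} c → Ends a b l → Ends a c (l ++ [ c ])
  Ends-∷ʳ c [-]     = _ ∷ [-]
  Ends-∷ʳ c (a ∷ e) = a ∷ Ends-∷ʳ c e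

  Ends-reverse : ∀ {a b l} → Ends a b l → Ends b a (reverse l)
  Ends-reverse [-]             = [-]
  Ends-reverse (_∷_ a {l = l} e) =
    subst (Ends _ a) (sym (unfold-reverse a l)) (Ends-∷ʳ a (Ends-reverse e))

  Ends-suffix : ∀ {a b m l₂} l₁ → Ends a b (l₁ ++ m ∷ l₂) → Ends m b (m ∷ l₂)
  Ends-suffix []               e       = Ends-restart e
  Ends-suffix (_ ∷ [])         (_ ∷ e) = Ends-restart e
  Ends-suffix (_ ∷ c ∷ l₁)     (_ ∷ e) = Ends-suffix (c ∷ l₁) e

  Ends-prefix : ∀ {a b m l₂} l₁ → Ends a b (l₁ ++ m ∷ l₂) → Ends a m (l₁ ++ [ m ])
  Ends-prefix []           [-]     = [-]
  Ends-prefix []           (_ ∷ _) = [-]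
  Ends-prefix (_ ∷ [])     (a ∷ e) = a ∷ Ends-prefix [] e
  Ends-prefix (_ ∷ c ∷ l₁) (a ∷ e) = a ∷ Ends-prefix (c ∷ l₁) e

  Ends-lookup-last : ∀ {a b h t} → Ends a b (h ∷ t) → lookup (h ∷ t) (fromℕ (length t)) ≡ b
  Ends-lookup-last [-]                = refl
  Ends-lookup-last {t = _ ∷ _} (_ ∷ e) = Ends-lookup-last e

  data LastView (P Q : A → Set) : List A → Set where
    lastAt : ∀ xs {y ys} → Q y → All P ys → LastView P Q (xs ++ y ∷ ys)

  module _ {Q : A → Set} (Q? : Decidable Q) where

    splitFirst : ∀ {xs} → Any Q xs → FirstView (∁ Q) Q xs
    splitFirst {x ∷ xs} qxs with Q? x | qxs
    ... | yes qx | _          = firstAt [] qx xs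
    ... | no ¬qx | here qx    = ⊥-elim (¬qx qx)
    ... | no ¬qx | there qxs′ with splitFirst qxs′
    ...   | firstAt ps qy ys = firstAt (¬qx ∷ ps) qy ys

    splitLast : ∀ {xs} → Any Q xs → LastView (∁ Q) Q xs
    splitLast {x ∷ xs} qxs with Any.any? Q? xs | qxs
    ... | yes qxs′ | _ with splitLast qxs′
    ...   | lastAt ys qy ps = lastAt (x ∷ ys) qy ps
    splitLast {x ∷ xs} qxs | no ¬qxs | here qx    = lastAt [] qx (¬Any⇒All¬ xs ¬qxs)
    splitLast {x ∷ xs} qxs | no ¬qxs | there qxs′ = ⊥-elim (¬qxs qxs′)

module _ {n : ℕ} (G : Graph n) where

  private
    V : Set
    V = Fin n

  Apart : V → V → Set
  Apart a b = a ≢ b × ¬ E G a b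

  Apart-sym : ∀ {a b} → Apart a b → Apart b a
  Apart-sym (a≢b , ¬ab) = a≢b ∘ sym , ¬ab ∘ E-sym G

  Separated : List V → List V → Set
  Separated A B = ∀ {a b} → a ∈ₗ A → b ∈ₗ B → Apart a b

  Separated-sym : ∀ {A B} → Separated A B → Separated B A
  Separated-sym sep b∈ a∈ = Apart-sym (sep a∈ b∈)

  Separated-mono : ∀ {A A′ B B′} → A′ ⊆ A → B′ ⊆ B → Separated A B → Separated A′ B′
  Separated-mono A′⊆A B′⊆B sep a∈ b∈ = sep (A′⊆A a∈) (B′⊆B b∈)

  Separated-∷ˡ : ∀ {a A B} → All (Apart a) B → Separated A B → Separated (a ∷ A) B
  Separated-∷ˡ apart sep (here refl) b∈ = All.lookup apart b∈
  Separated-∷ˡ apart sep (there a∈)  b∈ = sep a∈ b∈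

  Separated-∷ʳ : ∀ {b A B} → All (λ a → Apart a b) A → Separated A B → Separated A (b ∷ B)
  Separated-∷ʳ apart sep a∈ (here refl) = All.lookup apart a∈
  Separated-∷ʳ apart sep a∈ (there b∈)  = sep a∈ b∈

  Separated-meet : ∀ {c A B v} → Separated A B → v ∈ₗ c ∷ A → v ∈ₗ c ∷ B → v ≡ c
  Separated-meet _   (here refl) _           = refl
  Separated-meet _   (there _)   (here refl) = refl
  Separated-meet sep (there v∈)  (there v∈′) = ⊥-elim (proj₁ (sep v∈ v∈′) refl)

  Separated-edge : ∀ {c A B u v} → Separated A B → u ∈ₗ c ∷ A → v ∈ₗ c ∷ B → E G u v →
                   u ∈ₗ c ∷ B ⊎ v ∈ₗ c ∷ A
  Separated-edge _   (here refl) _           _  = inj₁ (here refl)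
  Separated-edge _   (there _)   (here refl) _  = inj₂ (here refl)
  Separated-edge sep (there u∈)  (there v∈)  uv = ⊥-elim (proj₂ (sep u∈ v∈) uv)

  SeparatedButHeads : V → List V → V → List V → Set
  SeparatedButHeads a A b B = Separated A (b ∷ B) × Separated (a ∷ A) B

  SeparatedButHeads-disjoint : ∀ {a b A B v} → E G a b → SeparatedButHeads a A b B →
                               v ∈ₗ a ∷ A → ¬ v ∈ₗ b ∷ B
  SeparatedButHeads-disjoint {a} ab _  (here refl) (here refl) = E-irr G a ab
  SeparatedButHeads-disjoint _ (_ , sep) (here refl) (there v∈) = proj₁ (sep (here refl) v∈) refl
  SeparatedButHeads-disjoint _ (sep , _) (there v∈)  v∈′        = proj₁ (sep v∈ v∈′) refl

  SeparatedButHeads-edge : ∀ {a b A B u v} → SeparatedButHeads a A b B →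
                           u ∈ₗ a ∷ A → v ∈ₗ b ∷ B → E G u v → SamePair u v a b
  SeparatedButHeads-edge _         (here refl) (here refl) _  = inj₁ (refl , refl)
  SeparatedButHeads-edge (_ , sep) (here refl) (there v∈)  uv = ⊥-elim (proj₂ (sep (here refl) v∈) uv)
  SeparatedButHeads-edge (sep , _) (there u∈)  v∈          uv = ⊥-elim (proj₂ (sep u∈ v∈) uv)

  data Induced : List V → Set where
    [-]  : ∀ {a} → Induced [ a ]
    cons : ∀ {a b l} → E G a b → All (Apart a) l → Induced (b ∷ l) → Induced (a ∷ b ∷ l)

  Induced-head∉ : ∀ {a l} → Induced (a ∷ l) → a ∉ₗ l
  Induced-head∉ (cons ab _ _)   (here refl) = E-irr G _ ab
  Induced-head∉ (cons _ apart _) (there a∈) = proj₁ (All.lookup apart a∈) refl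

  Induced-tail : ∀ {a b l} → Induced (a ∷ b ∷ l) → Induced (b ∷ l)
  Induced-tail (cons _ _ ind) = ind

  Induced-head-apart : ∀ {a b l} → Induced (a ∷ b ∷ l) → All (Apart a) l
  Induced-head-apart (cons _ apart _) = apart

  Induced-suffix : ∀ {m l₂} l₁ → Induced (l₁ ++ m ∷ l₂) → Induced (m ∷ l₂)
  Induced-suffix []           ind = ind
  Induced-suffix (_ ∷ [])     ind = Induced-tail ind
  Induced-suffix (_ ∷ c ∷ l₁) ind = Induced-suffix (c ∷ l₁) (Induced-tail ind)

  Induced-prefix : ∀ {m l₂} l₁ → Induced (l₁ ++ m ∷ l₂) → Induced (l₁ ++ [ m ])
  Induced-prefix []           _                  = [-]
  Induced-prefix (_ ∷ [])     (cons ab _ _)      = cons ab [] [-]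
  Induced-prefix (_ ∷ c ∷ l₁) (cons ab apart ind) =
    cons ab (anti-mono (prefix⊆ l₁) apart) (Induced-prefix (c ∷ l₁) ind)
    where
    prefix⊆ : ∀ {m l₂} l₁ → l₁ ++ [ m ] ⊆ l₁ ++ m ∷ l₂
    prefix⊆ []       (here refl) = here refl
    prefix⊆ (_ ∷ l₁) (here refl) = here refl
    prefix⊆ (_ ∷ l₁) (there v∈)  = there (prefix⊆ l₁ v∈)

  Induced-gap : ∀ {m l₂} l₁ → Induced (l₁ ++ m ∷ l₂) → Separated l₁ l₂
  Induced-gap (_ ∷ [])     (cons _ apart _)   (here refl) b∈ = All.lookup apart b∈
  Induced-gap (_ ∷ c ∷ l₁) (cons _ apart _)   (here refl) b∈ =
    All.lookup apart (∈-++⁺ʳ l₁ (there b∈))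
  Induced-gap (_ ∷ c ∷ l₁) (cons _ _ ind)     (there a∈)  b∈ = Induced-gap (c ∷ l₁) ind a∈ b∈

  Induced-∷ʳ : ∀ {b c} l → Induced (l ++ [ b ]) → E G b c → All (λ a → Apart a c) l →
               Induced (l ++ b ∷ [ c ])
  Induced-∷ʳ []           [-]                bc _              = cons bc [] [-]
  Induced-∷ʳ (_ ∷ [])     (cons ab [] [-])   bc (ac ∷ [])      = cons ab (ac ∷ []) (cons bc [] [-])
  Induced-∷ʳ {b} {c} (a ∷ d ∷ l) (cons ad apart ind) bc (ac ∷ apart′) =
    cons ad (subst (All (Apart a)) (++-assoc l [ b ] [ c ]) (∷ʳ⁺ apart ac))
         (Induced-∷ʳ (d ∷ l) ind bc apart′)

  Induced-reverse : ∀ {l} → Induced l → Induced (reverse l)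
  Induced-reverse [-] = [-]
  Induced-reverse (cons {a} {b} {l} ab apart ind) =
    subst Induced (sym reverse-aabl)
      (Induced-∷ʳ (reverse l) (subst Induced (unfold-reverse b l) (Induced-reverse ind))
                  (E-sym G ab) (All.map Apart-sym (anti-mono reverse⁻ apart)))
    where
    open ≡-Reasoning
    reverse-aabl : reverse (a ∷ b ∷ l) ≡ reverse l ++ b ∷ [ a ]
    reverse-aabl = begin
      reverse (a ∷ b ∷ l)        ≡⟨ unfold-reverse a (b ∷ l) ⟩
      reverse (b ∷ l) ++ [ a ]   ≡⟨ cong (_++ [ a ]) (unfold-reverse b l) ⟩
      (reverse l ++ [ b ]) ++ [ a ] ≡⟨ ++-assoc (reverse l) [ b ] [ a ] ⟩
      reverse l ++ b ∷ [ a ]     ∎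

  Induced-lookup-injective : ∀ {h t} → Induced (h ∷ t) → ∀ j k → lookup (h ∷ t) j ≡ lookup (h ∷ t) k → j ≡ k
  Induced-lookup-injective _             zero    zero    _  = refl
  Induced-lookup-injective ind           zero    (suc k) eq =
    ⊥-elim (Induced-head∉ ind (subst (_∈ₗ _) (sym eq) (∈-lookup k)))
  Induced-lookup-injective ind           (suc j) zero    eq =
    ⊥-elim (Induced-head∉ ind (subst (_∈ₗ _) eq (∈-lookup j)))
  Induced-lookup-injective (cons _ _ ind) (suc j) (suc k) eq =
    cong suc (Induced-lookup-injective ind j k eq)

  Induced-head-edge : ∀ {h t} → Induced (h ∷ t) → ∀ k → E G h (lookup t k) ⇔ (toℕ k ≡ 0)
  Induced-head-edge (cons hb _ _)    zero    = mk⇔ (λ _ → refl) (λ _ → hb)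
  Induced-head-edge (cons _ apart _) (suc k) =
    mk⇔ (λ e → ⊥-elim (proj₂ (All.lookup apart (∈-lookup k)) e)) λ ()

  Induced-lookup-edges : ∀ {h t} → Induced (h ∷ t) → ∀ j k →
    E G (lookup (h ∷ t) j) (lookup (h ∷ t) k) ⇔ Adjacent j k
  Induced-lookup-edges {h} _ zero zero = mk⇔ (⊥-elim ∘ E-irr G h) λ { (inj₁ ()) ; (inj₂ ()) }
  Induced-lookup-edges ind zero (suc k) =
    ⇔.trans (Induced-head-edge ind k) (mk⇔ (inj₁ ∘ cong suc) λ { (inj₁ eq) → suc-injective eq ; (inj₂ ()) })
  Induced-lookup-edges ind (suc j) zero =
    ⇔.trans (mk⇔ (E-sym G) (E-sym G))
      (⇔.trans (Induced-head-edge ind j) (mk⇔ (inj₂ ∘ cong suc) λ { (inj₁ ()) ; (inj₂ eq) → suc-injective eq }))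
  Induced-lookup-edges (cons _ _ ind) (suc j) (suc k) =
    ⇔.trans (Induced-lookup-edges ind j k) (⇔.sym (Adjacent-suc j k))

  toInducedPath : ∀ {a b l} → Induced l → Ends a b l → InducedPath G a b
  toInducedPath {l = h ∷ t} ind ends = record
    { len   = length t
    ; vtx   = lookup (h ∷ t)
    ; inj   = Induced-lookup-injective ind
    ; start = Ends-head ends
    ; end   = Ends-lookup-last ends
    ; edges = Induced-lookup-edges ind
    }

  OnPath-toInducedPath : ∀ {a b l} (ind : Induced l) (ends : Ends a b l) {v} →
                         OnPath (toInducedPath ind ends) v ⇔ v ∈ₗ l
  OnPath-toInducedPath {l = _ ∷ _} _ _ =
    mk⇔ (λ { (j , refl) → ∈-lookup j }) (λ v∈ → Any.index v∈ , sym (lookup-index v∈))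

  private
    consecutive : ∀ {m} (j k : Fin (suc m)) → toℕ k ≡ suc (toℕ j) →
                  Σ (Fin m) λ i → inject₁ i ≡ j × suc i ≡ k
    consecutive zero    (suc zero)    _  = zero , refl , refl
    consecutive {suc m} (suc j) (suc k) eq with consecutive j k (suc-injective eq)
    ... | i , refl , refl = suc i , refl , refl

  PathEdge-complete : ∀ {a b} (P : InducedPath G a b) {c d} → OnPath P c → OnPath P d → E G c d → PathEdge P c d
  PathEdge-complete P (j , refl) (k , refl) cd with Equivalence.to (edges P j k) cd
  ... | inj₁ k≡1+j with consecutive j k k≡1+j
  ...   | i , refl , refl = i , inj₁ (refl , refl)
  PathEdge-complete P (j , refl) (k , refl) cd | inj₂ j≡1+k with consecutive k j j≡1+k
  ...   | i , refl , refl = i , inj₂ (refl , refl)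

  PathEdge-sound : ∀ {a b} (P : InducedPath G a b) {c d} → PathEdge P c d → E G c d
  PathEdge-sound P (i , inj₁ (refl , refl)) =
    Equivalence.from (edges P (inject₁ i) (suc i)) (inj₁ (cong suc (sym (toℕ-inject₁ i))))
  PathEdge-sound P (i , inj₂ (refl , refl)) = E-sym G (PathEdge-sound P (i , inj₁ (refl , refl)))

  private
    ∈-++⇔ : ∀ {v} (A B : List V) → v ∈ₗ A ++ B ⇔ (v ∈ₗ A ⊎ v ∈ₗ B)
    ∈-++⇔ A B = ⇔.sym (↔⇒⇔ ++↔)

    ∈-++₃⇔ : ∀ {v} (A B C : List V) → v ∈ₗ A ++ B ++ C ⇔ (v ∈ₗ A ⊎ v ∈ₗ B ⊎ v ∈ₗ C)
    ∈-++₃⇔ A B C = ⇔.trans (∈-++⇔ A (B ++ C)) (⇔.refl ⊎-⇔ ∈-++⇔ B C)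

    swap : ∀ {c d a b : V} → SamePair c d a b → SamePair d c a b
    swap (inj₁ (p , q)) = inj₂ (q , p)
    swap (inj₂ (p , q)) = inj₁ (q , p)

    PathEdge-swap : ∀ {a b} (P : InducedPath G a b) {c d} → PathEdge P c d → PathEdge P d c
    PathEdge-swap P (i , s) = i , swap s

  PathEdge-within : ∀ {a b l c d} (ind : Induced l) (ends : Ends a b l) →
                    c ∈ₗ l → d ∈ₗ l → E G c d → PathEdge (toInducedPath ind ends) c d
  PathEdge-within {l = l} ind ends c∈ d∈ = PathEdge-complete (toInducedPath ind ends) (onPath c∈) (onPath d∈)
    where
    onPath : ∀ {v} → v ∈ₗ l → OnPath (toInducedPath ind ends) v
    onPath = Equivalence.from (OnPath-toInducedPath ind ends)

  OnPath-reversed : ∀ {a b l} (ind : Induced l) (ends : Ends a b l) {v} →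
    OnPath (toInducedPath (Induced-reverse ind) (Ends-reverse ends)) v ⇔ v ∈ₗ l
  OnPath-reversed ind ends = ⇔.trans (OnPath-toInducedPath _ _) (mk⇔ reverse⁻ reverse⁺)

  PathEdge-within-reversed : ∀ {a b l c d} (ind : Induced l) (ends : Ends a b l) →
    c ∈ₗ l → d ∈ₗ l → E G c d → PathEdge (toInducedPath (Induced-reverse ind) (Ends-reverse ends)) c d
  PathEdge-within-reversed ind ends c∈ d∈ =
    PathEdge-within (Induced-reverse ind) (Ends-reverse ends) (reverse⁺ c∈) (reverse⁺ d∈)

  centred-confluence : ∀ {c x y z A B C} →
    Induced (c ∷ A) → Ends c x (c ∷ A) →
    Induced (c ∷ B) → Ends c y (c ∷ B) →
    Induced (c ∷ C) → Ends c z (c ∷ C) →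
    Separated A B → Separated A C → Separated B C →
    ConfluenceType1 G (_∈ₗ (c ∷ A) ++ (c ∷ B) ++ (c ∷ C)) x y z
  centred-confluence {c} {A = A} {B} {C} iA eA iB eB iC eC sAB sAC sBC =
    c , Px , Py , Pz ,
    (λ v p q → Separated-meet sAB (Equivalence.to onX p) (Equivalence.to onY q)) ,
    (λ v p q → Separated-meet sAC (Equivalence.to onX p) (Equivalence.to onZ q)) ,
    (λ v p q → Separated-meet sBC (Equivalence.to onY p) (Equivalence.to onZ q)) ,
    (λ v → ⇔.trans (∈-++₃⇔ (c ∷ A) (c ∷ B) (c ∷ C)) (⇔.sym onX ⊎-⇔ ⇔.sym onY ⊎-⇔ ⇔.sym onZ)) ,
    λ u v u∈ v∈ → mk⇔ (edge (split u∈) (split v∈)) sound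
    where
    Px = toInducedPath iA eA
    Py = toInducedPath iB eB
    Pz = toInducedPath iC eC
    onX : ∀ {v} → OnPath Px v ⇔ v ∈ₗ c ∷ A
    onX = OnPath-toInducedPath iA eA
    onY : ∀ {v} → OnPath Py v ⇔ v ∈ₗ c ∷ B
    onY = OnPath-toInducedPath iB eB
    onZ : ∀ {v} → OnPath Pz v ⇔ v ∈ₗ c ∷ C
    onZ = OnPath-toInducedPath iC eC

    Branch : V → Set
    Branch v = v ∈ₗ c ∷ A ⊎ v ∈ₗ c ∷ B ⊎ v ∈ₗ c ∷ C

    split : ∀ {v} → v ∈ₗ (c ∷ A) ++ (c ∷ B) ++ (c ∷ C) → Branch v
    split = Equivalence.to (∈-++₃⇔ (c ∷ A) (c ∷ B) (c ∷ C))

    PE : V → V → Set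
    PE u v = PathEdge Px u v ⊎ PathEdge Py u v ⊎ PathEdge Pz u v

    onX-edge : ∀ {u v} → u ∈ₗ c ∷ A → v ∈ₗ c ∷ A → E G u v → PE u v
    onX-edge u∈ v∈ = inj₁ ∘ PathEdge-within iA eA u∈ v∈
    onY-edge : ∀ {u v} → u ∈ₗ c ∷ B → v ∈ₗ c ∷ B → E G u v → PE u v
    onY-edge u∈ v∈ = inj₂ ∘ inj₁ ∘ PathEdge-within iB eB u∈ v∈
    onZ-edge : ∀ {u v} → u ∈ₗ c ∷ C → v ∈ₗ c ∷ C → E G u v → PE u v
    onZ-edge u∈ v∈ = inj₂ ∘ inj₂ ∘ PathEdge-within iC eC u∈ v∈

    PE-swap : ∀ {u v} → PE u v → PE v u
    PE-swap (inj₁ p)        = inj₁ (PathEdge-swap Px p)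
    PE-swap (inj₂ (inj₁ p)) = inj₂ (inj₁ (PathEdge-swap Py p))
    PE-swap (inj₂ (inj₂ p)) = inj₂ (inj₂ (PathEdge-swap Pz p))

    crossXY : ∀ {u v} → u ∈ₗ c ∷ A → v ∈ₗ c ∷ B → E G u v → PE u v
    crossXY u∈ v∈ uv with Separated-edge sAB u∈ v∈ uv
    ... | inj₁ u∈B = onY-edge u∈B v∈ uv
    ... | inj₂ v∈A = onX-edge u∈ v∈A uv

    crossXZ : ∀ {u v} → u ∈ₗ c ∷ A → v ∈ₗ c ∷ C → E G u v → PE u v
    crossXZ u∈ v∈ uv with Separated-edge sAC u∈ v∈ uv
    ... | inj₁ u∈C = onZ-edge u∈C v∈ uv
    ... | inj₂ v∈A = onX-edge u∈ v∈A uv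

    crossYZ : ∀ {u v} → u ∈ₗ c ∷ B → v ∈ₗ c ∷ C → E G u v → PE u v
    crossYZ u∈ v∈ uv with Separated-edge sBC u∈ v∈ uv
    ... | inj₁ u∈C = onZ-edge u∈C v∈ uv
    ... | inj₂ v∈B = onY-edge u∈ v∈B uv

    edge : ∀ {u v} → Branch u → Branch v → E G u v → PE u v
    edge (inj₁ u∈)        (inj₁ v∈)        = onX-edge u∈ v∈
    edge (inj₁ u∈)        (inj₂ (inj₁ v∈)) = crossXY u∈ v∈
    edge (inj₁ u∈)        (inj₂ (inj₂ v∈)) = crossXZ u∈ v∈
    edge (inj₂ (inj₁ u∈)) (inj₁ v∈)        = PE-swap ∘ crossXY v∈ u∈ ∘ E-sym G
    edge (inj₂ (inj₁ u∈)) (inj₂ (inj₁ v∈)) = onY-edge u∈ v∈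
    edge (inj₂ (inj₁ u∈)) (inj₂ (inj₂ v∈)) = crossYZ u∈ v∈
    edge (inj₂ (inj₂ u∈)) (inj₁ v∈)        = PE-swap ∘ crossXZ v∈ u∈ ∘ E-sym G
    edge (inj₂ (inj₂ u∈)) (inj₂ (inj₁ v∈)) = PE-swap ∘ crossYZ v∈ u∈ ∘ E-sym G
    edge (inj₂ (inj₂ u∈)) (inj₂ (inj₂ v∈)) = onZ-edge u∈ v∈

    sound : ∀ {u v} → PE u v → E G u v
    sound (inj₁ p)        = PathEdge-sound Px p
    sound (inj₂ (inj₁ p)) = PathEdge-sound Py p
    sound (inj₂ (inj₂ p)) = PathEdge-sound Pz p

  triangle-confluence : ∀ {x′ y′ z′ x y z A B C} →
    Induced (x′ ∷ A) → Ends x′ x (x′ ∷ A) →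
    Induced (y′ ∷ B) → Ends y′ y (y′ ∷ B) →
    Induced (z′ ∷ C) → Ends z′ z (z′ ∷ C) →
    E G x′ y′ → E G y′ z′ → E G x′ z′ →
    SeparatedButHeads x′ A y′ B → SeparatedButHeads x′ A z′ C → SeparatedButHeads y′ B z′ C →
    ConfluenceType2 G (_∈ₗ (x′ ∷ A) ++ (y′ ∷ B) ++ (z′ ∷ C)) x y z
  triangle-confluence {x′} {y′} {z′} {A = A} {B} {C} iA eA iB eB iC eC x′y′ y′z′ x′z′ sAB sAC sBC =
    x′ , y′ , z′ , Px , Py , Pz ,
    (λ v p q → SeparatedButHeads-disjoint x′y′ sAB (Equivalence.to onX p) (Equivalence.to onY q)) ,
    (λ v p q → SeparatedButHeads-disjoint x′z′ sAC (Equivalence.to onX p) (Equivalence.to onZ q)) ,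
    (λ v p q → SeparatedButHeads-disjoint y′z′ sBC (Equivalence.to onY p) (Equivalence.to onZ q)) ,
    x′y′ , y′z′ , x′z′ ,
    (λ v → ⇔.trans (∈-++₃⇔ (x′ ∷ A) (y′ ∷ B) (z′ ∷ C)) (⇔.sym onX ⊎-⇔ ⇔.sym onY ⊎-⇔ ⇔.sym onZ)) ,
    λ u v u∈ v∈ → mk⇔ (edge (split u∈) (split v∈)) sound
    where
    Px = toInducedPath (Induced-reverse iA) (Ends-reverse eA)
    Py = toInducedPath (Induced-reverse iB) (Ends-reverse eB)
    Pz = toInducedPath (Induced-reverse iC) (Ends-reverse eC)

    onX : ∀ {v} → OnPath Px v ⇔ v ∈ₗ x′ ∷ A
    onX = OnPath-reversed iA eA
    onY : ∀ {v} → OnPath Py v ⇔ v ∈ₗ y′ ∷ B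
    onY = OnPath-reversed iB eB
    onZ : ∀ {v} → OnPath Pz v ⇔ v ∈ₗ z′ ∷ C
    onZ = OnPath-reversed iC eC

    Branch : V → Set
    Branch v = v ∈ₗ x′ ∷ A ⊎ v ∈ₗ y′ ∷ B ⊎ v ∈ₗ z′ ∷ C

    split : ∀ {v} → v ∈ₗ (x′ ∷ A) ++ (y′ ∷ B) ++ (z′ ∷ C) → Branch v
    split = Equivalence.to (∈-++₃⇔ (x′ ∷ A) (y′ ∷ B) (z′ ∷ C))

    PE : V → V → Set
    PE u v = PathEdge Px u v ⊎ PathEdge Py u v ⊎ PathEdge Pz u v ⊎
             SamePair u v x′ y′ ⊎ SamePair u v y′ z′ ⊎ SamePair u v x′ z′

    onX-edge : ∀ {u v} → u ∈ₗ x′ ∷ A → v ∈ₗ x′ ∷ A → E G u v → PE u v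
    onX-edge u∈ v∈ = inj₁ ∘ PathEdge-within-reversed iA eA u∈ v∈
    onY-edge : ∀ {u v} → u ∈ₗ y′ ∷ B → v ∈ₗ y′ ∷ B → E G u v → PE u v
    onY-edge u∈ v∈ = inj₂ ∘ inj₁ ∘ PathEdge-within-reversed iB eB u∈ v∈
    onZ-edge : ∀ {u v} → u ∈ₗ z′ ∷ C → v ∈ₗ z′ ∷ C → E G u v → PE u v
    onZ-edge u∈ v∈ = inj₂ ∘ inj₂ ∘ inj₁ ∘ PathEdge-within-reversed iC eC u∈ v∈

    x′y′-edge : ∀ {u v} → SamePair u v x′ y′ → PE u v
    x′y′-edge = inj₂ ∘ inj₂ ∘ inj₂ ∘ inj₁
    y′z′-edge : ∀ {u v} → SamePair u v y′ z′ → PE u v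
    y′z′-edge = inj₂ ∘ inj₂ ∘ inj₂ ∘ inj₂ ∘ inj₁
    x′z′-edge : ∀ {u v} → SamePair u v x′ z′ → PE u v
    x′z′-edge = inj₂ ∘ inj₂ ∘ inj₂ ∘ inj₂ ∘ inj₂

    edge : ∀ {u v} → Branch u → Branch v → E G u v → PE u v
    edge (inj₁ u∈)        (inj₁ v∈)        = onX-edge u∈ v∈
    edge (inj₂ (inj₁ u∈)) (inj₂ (inj₁ v∈)) = onY-edge u∈ v∈
    edge (inj₂ (inj₂ u∈)) (inj₂ (inj₂ v∈)) = onZ-edge u∈ v∈
    edge (inj₁ u∈)        (inj₂ (inj₁ v∈)) = x′y′-edge ∘ SeparatedButHeads-edge sAB u∈ v∈
    edge (inj₂ (inj₁ u∈)) (inj₂ (inj₂ v∈)) = y′z′-edge ∘ SeparatedButHeads-edge sBC u∈ v∈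
    edge (inj₁ u∈)        (inj₂ (inj₂ v∈)) = x′z′-edge ∘ SeparatedButHeads-edge sAC u∈ v∈
    edge (inj₂ (inj₁ u∈)) (inj₁ v∈)        = x′y′-edge ∘ swap ∘ SeparatedButHeads-edge sAB v∈ u∈ ∘ E-sym G
    edge (inj₂ (inj₂ u∈)) (inj₂ (inj₁ v∈)) = y′z′-edge ∘ swap ∘ SeparatedButHeads-edge sBC v∈ u∈ ∘ E-sym G
    edge (inj₂ (inj₂ u∈)) (inj₁ v∈)        = x′z′-edge ∘ swap ∘ SeparatedButHeads-edge sAC v∈ u∈ ∘ E-sym G

    SamePair-edge : ∀ {a b u v} → E G a b → SamePair u v a b → E G u v
    SamePair-edge ab (inj₁ (refl , refl)) = ab
    SamePair-edge ab (inj₂ (refl , refl)) = E-sym G ab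

    sound : ∀ {u v} → PE u v → E G u v
    sound (inj₁ p)                                = PathEdge-sound Px p
    sound (inj₂ (inj₁ p))                         = PathEdge-sound Py p
    sound (inj₂ (inj₂ (inj₁ p)))                  = PathEdge-sound Pz p
    sound (inj₂ (inj₂ (inj₂ (inj₁ s))))           = SamePair-edge x′y′ s
    sound (inj₂ (inj₂ (inj₂ (inj₂ (inj₁ s)))))    = SamePair-edge y′z′ s
    sound (inj₂ (inj₂ (inj₂ (inj₂ (inj₂ s)))))    = SamePair-edge x′z′ s

  vertices : ∀ {a b k} → Walk G a b k → List V
  vertices {a} here       = [ a ]
  vertices {a} (step _ w) = a ∷ vertices w

  vertices-ends : ∀ {a b k} (w : Walk G a b k) → Ends a b (vertices w)
  vertices-ends here            = [-]
  vertices-ends {a} (step _ w)  = a ∷ vertices-ends w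

  Walk-∷ʳ : ∀ {a b c k} → Walk G a b k → E G b c → Walk G a c (suc k)
  Walk-∷ʳ here       bc = step bc here
  Walk-∷ʳ (step e w) bc = step e (Walk-∷ʳ w bc)

  vertices-∷ʳ : ∀ {a b c k} (w : Walk G a b k) (bc : E G b c) →
                vertices (Walk-∷ʳ w bc) ≡ vertices w ++ [ c ]
  vertices-∷ʳ here           _  = refl
  vertices-∷ʳ {a} (step _ w) bc = cong (a ∷_) (vertices-∷ʳ w bc)

  Walk-reverse : ∀ {a b k} → Walk G a b k → Walk G b a k
  Walk-reverse here       = here
  Walk-reverse (step e w) = Walk-∷ʳ (Walk-reverse w) (E-sym G e)

  vertices-reverse : ∀ {a b k} (w : Walk G a b k) → vertices (Walk-reverse w) ≡ reverse (vertices w)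
  vertices-reverse here           = refl
  vertices-reverse {a} (step e w) = begin
    vertices (Walk-∷ʳ (Walk-reverse w) (E-sym G e)) ≡⟨ vertices-∷ʳ (Walk-reverse w) (E-sym G e) ⟩
    vertices (Walk-reverse w) ++ [ a ]              ≡⟨ cong (_++ [ a ]) (vertices-reverse w) ⟩
    reverse (vertices w) ++ [ a ]                   ≡⟨ unfold-reverse a (vertices w) ⟨
    reverse (a ∷ vertices w)                        ∎
    where open ≡-Reasoning

  _++ᵂ_ : ∀ {a b c k m} → Walk G a b k → Walk G b c m → Walk G a c (k + m)
  here     ++ᵂ w′ = w′
  step e w ++ᵂ w′ = step e (w ++ᵂ w′)

  vertices-++ᵂ : ∀ {a b c k m v} (w : Walk G a b k) (w′ : Walk G b c m) →
                 v ∈ₗ vertices (w ++ᵂ w′) → v ∈ₗ vertices w ⊎ v ∈ₗ vertices w′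
  vertices-++ᵂ here       _  v∈          = inj₂ v∈
  vertices-++ᵂ (step _ w) _  (here refl) = inj₁ (here refl)
  vertices-++ᵂ (step _ w) w′ (there v∈)  = Sum.map₁ there (vertices-++ᵂ w w′ v∈)

  WalkBelow : ℕ → V → V → Set
  WalkBelow k a v = ∃ λ j → j < k × Walk G a v j

  vertices-below : ∀ {a b k v} (w : Walk G a b k) → v ∈ₗ vertices w → v ≡ b ⊎ WalkBelow k a v
  vertices-below here       (here refl) = inj₁ refl
  vertices-below (step _ _) (here refl) = inj₂ (0 , s≤s z≤n , here)
  vertices-below (step e w) (there v∈) with vertices-below w v∈
  ... | inj₁ v≡b             = inj₁ v≡b
  ... | inj₂ (j , j<k , w′)  = inj₂ (suc j , s≤s j<k , step e w′)

  private
    Close : V → V → Set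
    Close a v = v ≡ a ⊎ E G a v

    Close? : ∀ a → Decidable (Close a)
    Close? a v = (v ≟ a) ⊎-dec E-dec G a v

    notClose⇒Apart : ∀ {a v} → ¬ Close a v → Apart a v
    notClose⇒Apart ¬close = (λ a≡v → ¬close (inj₁ (sym a≡v))) , ¬close ∘ inj₂

  -- shortcut the rest of the walk, then jump from the first vertex to the last vertex close to it
  shortcut : ∀ {a b k} (w : Walk G a b k) → ∃ λ l → Induced l × Ends a b l × l ⊆ vertices w
  shortcut {a} here = [ a ] , [-] , [-] , id
  shortcut {a} (step ab w) with shortcut w
  ... | l , ind , ends , l⊆ with splitLast (Close? a) (lose (Ends-first∈ ends) (inj₂ ab))
  ... | lastAt l₁ (inj₁ refl) _ =
    _ , Induced-suffix l₁ ind , Ends-suffix l₁ ends , there ∘ l⊆ ∘ ∈-++⁺ʳ l₁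
  ... | lastAt l₁ (inj₂ ac) far =
    _ , cons ac (All.map notClose⇒Apart far) (Induced-suffix l₁ ind) , a ∷ Ends-suffix l₁ ends ,
    ∷⁺ʳ a (l⊆ ∘ ∈-++⁺ʳ l₁)

  first-contact : ∀ {a b k} P (w : Walk G a b k) → a ∉ₗ P → b ∈ₗ P →
    ∃₂ λ q m → Σ (Walk G a q m) λ w′ →
      q ∉ₗ P × Any (E G q) P × (∀ {v} → v ∈ₗ vertices w′ → v ≡ q ⊎ All (Apart v) P) ×
      vertices w′ ⊆ vertices w
  first-contact P here a∉P a∈P = ⊥-elim (a∉P a∈P)
  first-contact {a} P (step ac w) a∉P b∈P with Any.any? (E-dec G a) P
  ... | yes a~P = a , 0 , here , a∉P , a~P , (λ { (here refl) → inj₁ refl }) , λ { (here refl) → here refl }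
  ... | no ¬a~P with first-contact P w (λ c∈P → ¬a~P (lose c∈P ac)) b∈P
  ...   | q , m , w′ , q∉P , q~P , far , w′⊆w =
    q , suc m , step ac w′ , q∉P , q~P ,
    (λ { (here refl) → inj₂ (All.tabulate λ p∈P → (λ { refl → a∉P p∈P }) , ¬a~P ∘ lose p∈P)
       ; (there v∈)  → far v∈ }) ,
    ∷⁺ʳ a w′⊆w

  Confluent : List V → V → V → V → Set
  Confluent T x y z = ∃ λ K → K ⊆ T × Confluence G (_∈ₗ K) x y z

  record Attachment (x y z q p : V) (L₁ L₂ R : List V) : Set where
    field
      path         : Induced (L₁ ++ p ∷ L₂)
      path-ends    : Ends x y (L₁ ++ p ∷ L₂)
      branch       : Induced (q ∷ R)
      branch-ends  : Ends q z (q ∷ R)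
      q∉path       : q ∉ₗ L₁ ++ p ∷ L₂
      branch-far   : Separated R (L₁ ++ p ∷ L₂)
      q~p          : E G q p
      first        : All (λ v → ¬ E G q v) L₁

  module Attached {x y z q p L₁ L₂ R} (att : Attachment x y z q p L₁ L₂ R) where
    open Attachment att public

    P : List V
    P = L₁ ++ p ∷ L₂

    T : List V
    T = P ++ q ∷ R

    L₁ʳ⊆P : reverse L₁ ⊆ P
    L₁ʳ⊆P = xs⊆xs++ys L₁ _ ∘ reverse⁻

    p∈P : p ∈ₗ P
    p∈P = ∈-++⁺ʳ L₁ (here refl)

    L₂⊆P : L₂ ⊆ P
    L₂⊆P = ∈-++⁺ʳ L₁ ∘ there

    P⊆T : P ⊆ T
    P⊆T = xs⊆xs++ys P _

    toT : ∀ {A} → A ⊆ P → A ⊆ T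
    toT A⊆P = P⊆T ∘ A⊆P

    Q⊆T : q ∷ R ⊆ T
    Q⊆T = xs⊆ys++xs _ P

    initial : Induced (p ∷ reverse L₁)
    initial = subst Induced (reverse-++ L₁ [ p ]) (Induced-reverse (Induced-prefix L₁ path))

    initial-ends : Ends p x (p ∷ reverse L₁)
    initial-ends = subst (Ends p x) (reverse-++ L₁ [ p ]) (Ends-reverse (Ends-prefix L₁ path-ends))

    initial⊆T : p ∷ reverse L₁ ⊆ T
    initial⊆T = toT (∈-∷⁺ʳ p∈P L₁ʳ⊆P)

    final : Induced (p ∷ L₂)
    final = Induced-suffix L₁ path

    final-ends : Ends p y (p ∷ L₂)
    final-ends = Ends-suffix L₁ path-ends

    far : ∀ {A} → A ⊆ P → Separated A R
    far A⊆P = Separated-sym (Separated-mono id A⊆P branch-far)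

    apart-q : ∀ {A} → A ⊆ P → All (λ v → ¬ E G q v) A → All (λ v → Apart v q) A
    apart-q A⊆P ¬q~ = All.tabulate λ v∈ →
      (λ { refl → q∉path (A⊆P v∈) }) , All.lookup ¬q~ v∈ ∘ E-sym G

    initial-q : Separated (reverse L₁) (q ∷ R)
    initial-q = Separated-∷ʳ (apart-q L₁ʳ⊆P (anti-mono reverse⁻ first)) (far L₁ʳ⊆P)

    gap : Separated (reverse L₁) L₂
    gap = Separated-mono reverse⁻ id (Induced-gap L₁ path)

  private
    ++₃-⊆ : ∀ {A B C T : List V} → A ⊆ T → B ⊆ T → C ⊆ T → A ++ B ++ C ⊆ T
    ++₃-⊆ {A} {B} A⊆ B⊆ C⊆ v∈ = Sum.[ A⊆ , Sum.[ B⊆ , C⊆ ]′ ∘ ∈-++⁻ B ]′ (∈-++⁻ A v∈)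

  attach-single : ∀ {x y z q p L₁ L₂ R} (att : Attachment x y z q p L₁ L₂ R) →
    All (λ v → ¬ E G q v) L₂ → Confluent (Attached.T att) x y z
  attach-single {q = q} {p} {L₁} {L₂} {R} att ¬q~L₂ =
    _ , ++₃-⊆ initial⊆T (toT (∈-++⁺ʳ L₁)) (∈-∷⁺ʳ (P⊆T p∈P) Q⊆T) ,
    inj₁ (centred-confluence initial initial-ends final final-ends to-z (p ∷ branch-ends)
                             gap initial-q final-q)
    where
    open Attached att
    to-z : Induced (p ∷ q ∷ R)
    to-z = cons (E-sym G q~p) (All.tabulate λ r∈ → Apart-sym (branch-far r∈ p∈P)) branch
    final-q : Separated L₂ (q ∷ R)
    final-q = Separated-∷ʳ (apart-q L₂⊆P ¬q~L₂) (far L₂⊆P)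

  attach-triangle : ∀ {x y z q p r L₁ R′ R} (att : Attachment x y z q p L₁ (r ∷ R′) R) →
    E G q r → All (λ v → ¬ E G q v) R′ → Confluent (Attached.T att) x y z
  attach-triangle {q = q} {p} {r} {L₁} {R′} {R} att q~r ¬q~R′ =
    _ , ++₃-⊆ initial⊆T (toT (∈-++⁺ʳ L₁ ∘ there)) Q⊆T ,
    inj₂ (triangle-confluence initial initial-ends (Induced-tail final) (Ends-suffix [ p ] final-ends)
                              branch branch-ends p~r (E-sym G q~r) (E-sym G q~p)
                              (gap , Separated-∷ˡ (Induced-head-apart final) (Separated-mono id there gap))
                              (initial-q , far (∈-∷⁺ʳ p∈P L₁ʳ⊆P))
                              (R′-q , far L₂⊆P))
    where
    open Attached att
    p~r : E G p r
    p~r = Equivalence.from (Induced-head-edge final zero) refl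
    R′-q : Separated R′ (q ∷ R)
    R′-q = Separated-∷ʳ (apart-q (L₂⊆P ∘ there) ¬q~R′) (far (L₂⊆P ∘ there))

  attach-spread : ∀ {x y z q p m r L₁ M R′ R} (att : Attachment x y z q p L₁ (m ∷ M ++ r ∷ R′) R) →
    E G q r → All (λ v → ¬ E G q v) R′ → Confluent (Attached.T att) x y z
  attach-spread {q = q} {p} {m} {r} {L₁} {M} {R′} {R} att q~r ¬q~R′ =
    _ , ++₃-⊆ (∈-∷⁺ʳ (Q⊆T (here refl)) initial⊆T) (∈-∷⁺ʳ (Q⊆T (here refl)) (toT r∷R′⊆P)) Q⊆T ,
    inj₁ (centred-confluence to-x (q ∷ initial-ends) to-y (q ∷ Ends-suffix (p ∷ m ∷ M) final-ends)
                             branch branch-ends m-between (far (∈-∷⁺ʳ p∈P L₁ʳ⊆P)) (far r∷R′⊆P))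
    where
    open Attached att
    beyond-m : r ∷ R′ ⊆ M ++ r ∷ R′
    beyond-m = xs⊆ys++xs _ M
    r∷R′⊆P : r ∷ R′ ⊆ P
    r∷R′⊆P = L₂⊆P ∘ there ∘ beyond-m
    to-x : Induced (q ∷ p ∷ reverse L₁)
    to-x = cons q~p (All.map Apart-sym (apart-q L₁ʳ⊆P (anti-mono reverse⁻ first))) initial
    to-y : Induced (q ∷ r ∷ R′)
    to-y = cons q~r (All.map Apart-sym (apart-q (r∷R′⊆P ∘ there) ¬q~R′)) (Induced-suffix (p ∷ m ∷ M) final)
    m-between : Separated (p ∷ reverse L₁) (r ∷ R′)
    m-between = Separated-∷ˡ (anti-mono beyond-m (Induced-head-apart final))
                             (Separated-mono id (there ∘ beyond-m) gap)

  Attachment-confluent : ∀ {x y z q p L₁ L₂ R} (att : Attachment x y z q p L₁ L₂ R) →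
                         Confluent (Attached.T att) x y z
  Attachment-confluent {q = q} {L₂ = L₂} att with Any.any? (E-dec G q) L₂
  ... | no ¬q~L₂ = attach-single att (¬Any⇒All¬ L₂ ¬q~L₂)
  ... | yes q~L₂ with splitLast (E-dec G q) q~L₂
  ...   | lastAt []      q~r ¬q~R′ = attach-triangle att q~r ¬q~R′
  ...   | lastAt (_ ∷ _) q~r ¬q~R′ = attach-spread att q~r ¬q~R′

  attach : ∀ {x y z q} P R → Induced P → Ends x y P → Induced (q ∷ R) → Ends q z (q ∷ R) →
           q ∉ₗ P → Separated R P → Any (E G q) P → Confluent (P ++ q ∷ R) x y z
  attach {q = q} _ _ indP endsP indQ endsQ q∉P far q~P with splitFirst (E-dec G q) q~P
  ... | firstAt first q~p _ = Attachment-confluent record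
    { path = indP ; path-ends = endsP ; branch = indQ ; branch-ends = endsQ
    ; q∉path = q∉P ; branch-far = far ; q~p = q~p ; first = first }

  Walk? : ∀ a b k → Dec (Walk G a b k)
  Walk? a b zero with a ≟ b
  ... | yes refl = yes here
  ... | no a≢b   = no λ { here → a≢b refl }
  Walk? a b (suc k) with any? (λ c → E-dec G a c ×-dec Walk? c b k)
  ... | yes (c , ac , w) = yes (step ac w)
  ... | no ∄w            = no λ { (step ac w) → ∄w (_ , ac , w) }

  WalkBelow⇒N : ∀ {i a v} → WalkBelow i a v → ∃ λ j → j < i × N G j a v
  WalkBelow⇒N {a = a} {v} (j , j<i , w) with least (Walk? a v) w
  ... | j′ , j′≤j , w′ , shortest = j′ , ≤-<-trans j′≤j j<i , w′ , shortest

  N⇒¬WalkBelow : ∀ {i a v} → N G i a v → ¬ WalkBelow i a v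
  N⇒¬WalkBelow (_ , shortest) (j , j<i , w) = shortest j j<i w

  through-centre : ∀ {u a b i v} (wa : Walk G u a i) (wb : Walk G u b i) →
    v ∈ₗ vertices (Walk-reverse wa ++ᵂ wb) → v ≡ a ⊎ v ≡ b ⊎ WalkBelow i u v
  through-centre wa wb v∈ with vertices-++ᵂ (Walk-reverse wa) wb v∈
  ... | inj₁ v∈a = Sum.map₂ inj₂ (vertices-below wa (reverse⁻ (subst (_ ∈ₗ_) (vertices-reverse wa) v∈a)))
  ... | inj₂ v∈b = inj₂ (vertices-below wb v∈b)

  path-between : ∀ {u x y i} → Walk G u x i → Walk G u y i →
    ∃ λ P → Induced P × Ends x y P × (∀ {v} → v ∈ₗ P → v ≡ x ⊎ v ≡ y ⊎ WalkBelow i u v)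
  path-between wx wy with shortcut (Walk-reverse wx ++ᵂ wy)
  ... | P , ind , ends , P⊆ = P , ind , ends , through-centre wx wy ∘ P⊆

  branch-towards : ∀ {u x z i} P → Walk G u z i → Walk G u x i → z ∉ₗ P → x ∈ₗ P →
    ∃₂ λ q R → Induced (q ∷ R) × Ends q z (q ∷ R) × q ∉ₗ P × Separated R P × Any (E G q) P ×
               (∀ {v} → v ∈ₗ q ∷ R → v ≡ z ⊎ v ≡ x ⊎ WalkBelow i u v)
  branch-towards P wz wx z∉P x∈P with first-contact P (Walk-reverse wz ++ᵂ wx) z∉P x∈P
  ... | q , _ , w , q∉P , q~P , near , w⊆ with shortcut (Walk-reverse w)
  ... | [] , _ , () , _
  ... | _ ∷ R , ind , ends , Q⊆ with Ends-head ends
  ... | refl = q , R , ind , ends , q∉P , far , q~P , through-centre wz wx ∘ w⊆ ∘ on-w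
    where
    on-w : ∀ {v} → v ∈ₗ q ∷ R → v ∈ₗ vertices w
    on-w = reverse⁻ ∘ subst (_ ∈ₗ_) (vertices-reverse w) ∘ Q⊆
    far : Separated R P
    far r∈ p∈ with near (on-w (there r∈))
    ... | inj₁ refl   = ⊥-elim (Induced-head∉ ind r∈)
    ... | inj₂ apart = All.lookup apart p∈

  confluent-around : ∀ {u x y z i} → x ≢ z → y ≢ z → Walk G u x i → Walk G u y i → N G i u z →
    ∃ λ T → (∀ {v} → v ∈ₗ T → WalkBelow i u v ⊎ v ≡ x ⊎ v ≡ y ⊎ v ≡ z) × Confluent T x y z
  confluent-around {u} {x} {y} {z} {i} x≢z y≢z wx wy Nz@(wz , _) with path-between wx wy
  ... | P , indP , endsP , nearP
    with branch-towards P wz wx (Sum.[ x≢z ∘ sym , Sum.[ y≢z ∘ sym , N⇒¬WalkBelow Nz ]′ ]′ ∘ nearP)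
                        (Ends-first∈ endsP)
  ... | q , R , indQ , endsQ , q∉P , far , q~P , nearQ =
    P ++ q ∷ R , Sum.[ fromP ∘ nearP , fromQ ∘ nearQ ]′ ∘ ∈-++⁻ P ,
    attach P R indP endsP indQ endsQ q∉P far q~P
    where
    fromP : ∀ {v} → v ≡ x ⊎ v ≡ y ⊎ WalkBelow i u v → WalkBelow i u v ⊎ v ≡ x ⊎ v ≡ y ⊎ v ≡ z
    fromP = Sum.[ inj₂ ∘ inj₁ , Sum.[ inj₂ ∘ inj₂ ∘ inj₁ , inj₁ ]′ ]′
    fromQ : ∀ {v} → v ≡ z ⊎ v ≡ x ⊎ WalkBelow i u v → WalkBelow i u v ⊎ v ≡ x ⊎ v ≡ y ⊎ v ≡ z
    fromQ = Sum.[ inj₂ ∘ inj₂ ∘ inj₂ , Sum.[ inj₂ ∘ inj₁ , inj₁ ]′ ]′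

  Confluence-resp : ∀ {X Y : V → Set} {x y z} → (∀ v → X v ⇔ Y v) →
                    Confluence G X x y z → Confluence G Y x y z
  Confluence-resp X⇔Y (inj₁ (c , Px , Py , Pz , dxy , dxz , dyz , vs , es)) =
    inj₁ (c , Px , Py , Pz , dxy , dxz , dyz ,
          (λ v → ⇔.trans (⇔.sym (X⇔Y v)) (vs v)) ,
          λ u v Yu Yv → es u v (Equivalence.from (X⇔Y u) Yu) (Equivalence.from (X⇔Y v) Yv))
  Confluence-resp X⇔Y (inj₂ (x′ , y′ , z′ , Px , Py , Pz , dxy , dxz , dyz , x′y′ , y′z′ , x′z′ , vs , es)) =
    inj₂ (x′ , y′ , z′ , Px , Py , Pz , dxy , dxz , dyz , x′y′ , y′z′ , x′z′ ,
          (λ v → ⇔.trans (⇔.sym (X⇔Y v)) (vs v)) ,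
          λ u v Yu Yv → es u v (Equivalence.from (X⇔Y u) Yu) (Equivalence.from (X⇔Y v) Yv))

  Confluence-ends : ∀ {X : V → Set} {x y z} → Confluence G X x y z → X x × X y × X z
  Confluence-ends (inj₁ (_ , Px , Py , Pz , _ , _ , _ , vs , _)) =
    Equivalence.from (vs _) (inj₁ (OnPath-end Px)) ,
    Equivalence.from (vs _) (inj₂ (inj₁ (OnPath-end Py))) ,
    Equivalence.from (vs _) (inj₂ (inj₂ (OnPath-end Pz)))
    where
    OnPath-end : ∀ {a b} (P : InducedPath G a b) → OnPath P b
    OnPath-end P = fromℕ (len P) , end P
  Confluence-ends (inj₂ (_ , _ , _ , Px , Py , Pz , _ , _ , _ , _ , _ , _ , vs , _)) =
    Equivalence.from (vs _) (inj₁ (OnPath-start Px)) ,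
    Equivalence.from (vs _) (inj₂ (inj₁ (OnPath-start Py))) ,
    Equivalence.from (vs _) (inj₂ (inj₂ (OnPath-start Pz)))
    where
    OnPath-start : ∀ {a b} (P : InducedPath G a b) → OnPath P a
    OnPath-start P = zero , start P

fromList : ∀ {n} → List (Fin n) → Subset n
fromList = foldr (λ v S → ⁅ v ⁆ ∪ S) ∅

∈-fromList⁺ : ∀ {n} {v : Fin n} {l} → v ∈ₗ l → v ∈ fromList l
∈-fromList⁺ (here refl) = x∈p∪q⁺ (inj₁ (x∈⁅x⁆ _))
∈-fromList⁺ (there v∈)  = x∈p∪q⁺ (inj₂ (∈-fromList⁺ v∈))

∈-fromList⁻ : ∀ {n} {v : Fin n} l → v ∈ fromList l → v ∈ₗ l
∈-fromList⁻ []      v∈ = ⊥-elim (∉⊥ v∈)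
∈-fromList⁻ (w ∷ l) v∈ with x∈p∪q⁻ ⁅ w ⁆ (fromList l) v∈
... | inj₁ v∈w = here (x∈⁅y⁆⇒x≡y w v∈w)
... | inj₂ v∈l = there (∈-fromList⁻ l v∈l)

Confluence-subset : ∀ {n} {G : Graph n} {x y z : Fin n} (B : Fin n → Set) {K} →
  (∀ {v} → v ∈ₗ K → B v ⊎ v ≡ x ⊎ v ≡ y ⊎ v ≡ z) → Confluence G (_∈ₗ K) x y z →
  Σ (Subset n) λ S → (∀ v → v ∈ S → B v) × Confluence G (λ v → v ∈ S ⊎ v ≡ x ⊎ v ≡ y ⊎ v ≡ z) x y z
Confluence-subset {n} {G} {x} {y} {z} B {K} near conf = S , S⊆B , Confluence-resp G K⇔ conf
  where
  open import Data.List.Membership.DecPropositional (_≟_ {n}) using (_∈?_)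

  xyz : List (Fin n)
  xyz = x ∷ y ∷ z ∷ []

  S : Subset n
  S = fromList (filter (λ v → ¬? (v ∈? xyz)) K)

  S⊆K∖xyz : ∀ {v} → v ∈ S → v ∈ₗ K × v ∉ₗ xyz
  S⊆K∖xyz = ∈-filter⁻ (λ v → ¬? (v ∈? xyz)) ∘ ∈-fromList⁻ _

  S⊆B : ∀ v → v ∈ S → B v
  S⊆B v v∈S with S⊆K∖xyz v∈S
  ... | v∈K , v∉xyz = Sum.[ id , ⊥-elim ∘ v∉xyz ∘ ∈xyz ]′ (near v∈K)
    where
    ∈xyz : v ≡ x ⊎ v ≡ y ⊎ v ≡ z → v ∈ₗ xyz
    ∈xyz = Sum.[ here , there ∘ Sum.[ here , there ∘ here ]′ ]′

  ends : x ∈ₗ K × y ∈ₗ K × z ∈ₗ K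
  ends = Confluence-ends G conf

  K⇔ : ∀ v → v ∈ₗ K ⇔ (v ∈ S ⊎ v ≡ x ⊎ v ≡ y ⊎ v ≡ z)
  K⇔ v = mk⇔ to from
    where
    to : v ∈ₗ K → v ∈ S ⊎ v ≡ x ⊎ v ≡ y ⊎ v ≡ z
    to v∈K with v ∈? xyz
    ... | yes (here v≡x)                 = inj₂ (inj₁ v≡x)
    ... | yes (there (here v≡y))         = inj₂ (inj₂ (inj₁ v≡y))
    ... | yes (there (there (here v≡z))) = inj₂ (inj₂ (inj₂ v≡z))
    ... | no v∉xyz = inj₁ (∈-fromList⁺ (∈-filter⁺ (λ v → ¬? (v ∈? xyz)) v∈K v∉xyz))
    from : v ∈ S ⊎ v ≡ x ⊎ v ≡ y ⊎ v ≡ z → v ∈ₗ K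
    from (inj₁ v∈S)                = proj₁ (S⊆K∖xyz v∈S)
    from (inj₂ (inj₁ refl))        = proj₁ ends
    from (inj₂ (inj₂ (inj₁ refl))) = proj₁ (proj₂ ends)
    from (inj₂ (inj₂ (inj₂ refl))) = proj₂ (proj₂ ends)

lemma2p5 : ∀ {n} (G : Graph n) (u : Fin n) (i : ℕ) → 1 ≤ i →
    (x y z : Fin n) → x ≢ y → y ≢ z → x ≢ z →
    N G i u x → N G i u y → N G i u z →
    Σ (Subset n) λ S →
      (∀ v → v ∈ S → ∃ λ j → j < i × N G j u v) ×
      Confluence G (λ v → v ∈ S ⊎ v ≡ x ⊎ v ≡ y ⊎ v ≡ z) x y z
lemma2p5 G u i _ x y z _ y≢z x≢z (wx , _) (wy , _) Nz
  with confluent-around G x≢z y≢z wx wy Nz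
... | T , T-near , K , K⊆T , conf =
  Confluence-subset _ (Sum.map₁ (WalkBelow⇒N G) ∘ T-near ∘ K⊆T) conf
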